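{- Let $N\ge 2$, $r\ge 2$, $e_0,\dots,e_{r-1}$ distinct reals, and ${\bf k}=(k_0,\dots,k_{r-1})$ positive integers with $\sum_m k_m=N$. Let $g_1,\dots,g_N$ be real functions on $\{e_0,\dots,e_{r-1}\}$, each satisfying $\sum_{m=0}^{r-1}k_m g_\ell(e_m)=0$. Then $\sum_{\ell=1}^N g_\ell(x_\ell)=0$ for all $x\in\mathcal V_{N,{\bf k}}$ if and only if $g_1=g_2=\cdots=g_N$.
   Context: $\mathcal V_{N,{\bf k}}$ is the set of $N$-tuples $x=(x_1,\dots,x_N)\in\{e_0,\dots,e_{r-1}\}^N$ with exactly $k_m$ entries equal to $e_m$ for each $m$. -}

module Defs where

open import Level using (_⊔_)
open import Data.Nat using (ℕ; zero; suc)
import Data.Nat as ℕ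
open import Data.Fin using (Fin; zero; suc)
open import Data.Fin.Properties using (_≟_)
open import Data.List using (List; foldr; map; filter; length; allFin)
open import Relation.Binary.PropositionalEquality using (_≡_)
open import Algebra.Bundles using (CommutativeRing)

sumℕ : ∀ {n} → (Fin n → ℕ) → ℕ
sumℕ {n} f = foldr ℕ._+_ 0 (map f (allFin n))

count : ∀ {N r} → (Fin N → Fin r) → Fin r → ℕ
count {N} x m = length (filter (λ ℓ → x ℓ ≟ m) (allFin N))

-- x ∈ 𝒱_{N,k}: exactly k m entries of x equal e_m (e_m identified with index m).
InV : ∀ {N r} → (Fin r → ℕ) → (Fin N → Fin r) → Set
InV {r = r} k x = (m : Fin r) → count x m ≡ k m

module _ {c ℓ} (R : CommutativeRing c ℓ) where
  open CommutativeRing R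

  sumR : ∀ {n} → (Fin n → Carrier) → Carrier
  sumR {n} f = foldr _+_ 0# (map f (allFin n))

  natMul : ℕ → Carrier → Carrier
  natMul zero    a = 0#
  natMul (suc n) a = a + natMul n a

  -- Characteristic zero / torsion-free (as ℝ is): (n+1)·a = 0 implies a = 0.
  TorsionFree : Set (c ⊔ ℓ)
  TorsionFree = ∀ (n : ℕ) (a : Carrier) → natMul (suc n) a ≈ 0# → a ≈ 0#

-- Swapping the entries at two positions i ≠ j of a vector in 𝒱 keeps it in 𝒱 and changes the
-- vanishing sum only at i and j. Since every value occurs, two values a ≠ b can be put at i and j,
-- so g i a + g j b = g i b + g j a for all a, b. Weighting this by k a and summing over a, the
-- centring of g i and g j leaves N · g i b = N · g j b, and torsion-freeness cancels N.
-- Conversely, a common centred g sums over any x ∈ 𝒱 to Σ_m k m · g m = 0.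

module Submission where

open import Defs
open import Data.Nat as ℕ using (ℕ; zero; suc; _≤_; s≤s; NonZero)
import Data.Nat.Properties as ℕₚ
open import Data.Bool using (Bool; true; false)
open import Data.Fin using (Fin; zero; suc; punchIn)
open import Data.Fin.Properties using (_≟_; punchInᵢ≢i)
open import Data.Fin.Permutation using (Permutation; _⟨$⟩ʳ_; transpose)
import Data.List as List
import Data.List.Properties as Listₚ
open import Data.Vec.Functional as Vector using (Vector; _∷_; removeAt; updateAt)
open import Data.Vec.Functional.Properties using (updateAt-updates; updateAt-minimal)
open import Algebra.Bundles using (CommutativeMonoid; CommutativeRing)
open import Data.Product as Product using (Σ; ∃-syntax; _×_; _,_; proj₁; proj₂)
open import Function using (_∘_; id; const)
open import Relation.Nullary using (Dec; yes; no; does)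
open import Relation.Nullary.Decidable using (dec-true; dec-false)
open import Relation.Unary using (Pred)
open import Relation.Binary.PropositionalEquality using (_≡_; _≢_; refl; sym; trans; cong; cong₂; subst; module ≡-Reasoning)
import Algebra.Properties.CommutativeMonoid.Sum as CommutativeMonoidSum

module ℕΣ = CommutativeMonoidSum ℕₚ.+-0-commutativeMonoid

foldr-map-allFin : ∀ {a b} {A : Set a} {B : Set b} (f : A → B → B) (e : B) {n} (h : Fin n → A) →
                   List.foldr f e (List.map h (List.allFin n)) ≡ Vector.foldr f e h
foldr-map-allFin f e h = trans (cong (List.foldr f e) (Listₚ.map-tabulate id h)) (foldr-tabulate h)
  where
  foldr-tabulate : ∀ {n} (h : Fin n → _) → List.foldr f e (List.tabulate h) ≡ Vector.foldr f e h
  foldr-tabulate {zero}  h = refl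
  foldr-tabulate {suc n} h = cong (f (h zero)) (foldr-tabulate (h ∘ suc))

sumℕ≡sum : ∀ {n} (k : Fin n → ℕ) → sumℕ k ≡ ℕΣ.sum k
sumℕ≡sum = foldr-map-allFin ℕ._+_ 0

indicator : Bool → ℕ
indicator true  = 1
indicator false = 0

length-filter-tabulate : ∀ {a p} {A : Set a} {P : Pred A p} (P? : ∀ x → Dec (P x)) {n} (h : Fin n → A) →
                         List.length (List.filter P? (List.tabulate h)) ≡ ℕΣ.sum (λ l → indicator (does (P? (h l))))
length-filter-tabulate P? {zero}  h = refl
length-filter-tabulate P? {suc n} h with does (P? (h zero))
... | true  = cong suc (length-filter-tabulate P? (h ∘ suc))
... | false = length-filter-tabulate P? (h ∘ suc)

occurrences : ∀ {N r} → (Fin N → Fin r) → Fin r → ℕ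
occurrences x m = ℕΣ.sum (λ l → indicator (does (x l ≟ m)))

count≡occurrences : ∀ {N r} (x : Fin N → Fin r) m → count x m ≡ occurrences x m
count≡occurrences x m = length-filter-tabulate (λ l → x l ≟ m) id

occurrences-permute : ∀ {N r} (x : Fin N → Fin r) (π : Permutation N N) m →
                      occurrences (x ∘ (π ⟨$⟩ʳ_)) m ≡ occurrences x m
occurrences-permute x π m = sym (ℕΣ.sum-permute (λ l → indicator (does (x l ≟ m))) π)

occurrence : ∀ {N r} (x : Fin N → Fin r) m → 1 ≤ occurrences x m → ∃[ p ] x p ≡ m
occurrence {suc N} x m 1≤occ with x zero ≟ m
... | yes x₀≡m = zero , x₀≡m
... | no  _    = Product.map suc id (occurrence (x ∘ suc) m 1≤occ)

prepend : ∀ {a} {A : Set a} {n} (b : ℕ) → A → Vector A n → Vector A (b ℕ.+ n)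
prepend zero    c y = y
prepend (suc b) c y = c ∷ prepend b c y

occurrences-prepend : ∀ {n r} b c (y : Fin n → Fin r) m →
                      occurrences (prepend b c y) m ≡ b ℕ.* indicator (does (c ≟ m)) ℕ.+ occurrences y m
occurrences-prepend zero    c y m = refl
occurrences-prepend (suc b) c y m = trans (cong (indicator (does (c ≟ m)) ℕ.+_) (occurrences-prepend b c y m))
                                          (sym (ℕₚ.+-assoc (indicator (does (c ≟ m))) _ _))

canonical : ∀ {r} (k : Fin r → ℕ) → Fin (ℕΣ.sum k) → Fin r
canonical {zero}  k ()
canonical {suc r} k = prepend (k zero) zero (suc ∘ canonical (k ∘ suc))

occurrences-canonical : ∀ {r} (k : Fin r → ℕ) m → occurrences (canonical k) m ≡ k m
occurrences-canonical {suc r} k zero = begin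
  occurrences (canonical k) zero                        ≡⟨ occurrences-prepend (k zero) zero _ zero ⟩
  k zero ℕ.* 1 ℕ.+ ℕΣ.sum (Vector.replicate rest 0)     ≡⟨ cong₂ ℕ._+_ (ℕₚ.*-identityʳ (k zero)) (ℕΣ.sum-replicate-zero rest) ⟩
  k zero ℕ.+ 0                                          ≡⟨ ℕₚ.+-identityʳ (k zero) ⟩
  k zero                                                ∎
  where
  open ≡-Reasoning
  rest = ℕΣ.sum (k ∘ suc)
occurrences-canonical {suc r} k (suc m) = trans (occurrences-prepend (k zero) zero _ (suc m))
  (cong₂ ℕ._+_ (ℕₚ.*-zeroʳ (k zero)) (occurrences-canonical (k ∘ suc) m))

transpose-left : ∀ {n} (i j : Fin n) → transpose i j ⟨$⟩ʳ i ≡ j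
transpose-left i j rewrite dec-true (i ≟ i) refl = refl

transpose-right : ∀ {n} (i j : Fin n) → transpose i j ⟨$⟩ʳ j ≡ i
transpose-right i j with j ≟ i
... | yes j≡i = j≡i
... | no  _   rewrite dec-true (j ≟ j) refl = refl

transpose-fixed : ∀ {n} (i j l : Fin n) → l ≢ i → l ≢ j → transpose i j ⟨$⟩ʳ l ≡ l
transpose-fixed i j l l≢i l≢j rewrite dec-false (l ≟ i) l≢i | dec-false (l ≟ j) l≢j = refl

module _ {r} (k : Fin r → ℕ) where

  InV⇒occurrences : ∀ {N} (x : Fin N → Fin r) → InV k x → ∀ m → occurrences x m ≡ k m
  InV⇒occurrences x x∈V m = trans (sym (count≡occurrences x m)) (x∈V m)

  occurrences⇒InV : ∀ {N} (x : Fin N → Fin r) → (∀ m → occurrences x m ≡ k m) → InV k x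
  occurrences⇒InV x occ m = trans (count≡occurrences x m) (occ m)

  InV-permute : ∀ {N} (x : Fin N → Fin r) (π : Permutation N N) → InV k x → InV k (x ∘ (π ⟨$⟩ʳ_))
  InV-permute x π x∈V = occurrences⇒InV (x ∘ (π ⟨$⟩ʳ_)) λ m →
    trans (occurrences-permute x π m) (InV⇒occurrences x x∈V m)

  InV-inhabited : ∀ {N} → sumℕ k ≡ N → Σ (Fin N → Fin r) (InV k)
  InV-inhabited Σk≡N = subst (λ N → Σ (Fin N → Fin r) (InV k)) (trans (sym (sumℕ≡sum k)) Σk≡N)
    (canonical k , occurrences⇒InV (canonical k) (occurrences-canonical k))

  module _ (k-positive : ∀ m → 1 ≤ k m) where

    InV-occurrence : ∀ {N} (x : Fin N → Fin r) → InV k x → ∀ m → ∃[ p ] x p ≡ m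
    InV-occurrence x x∈V m = occurrence x m (subst (1 ≤_) (sym (InV⇒occurrences x x∈V m)) (k-positive m))

    InV-place : ∀ {N} (x : Fin N → Fin r) → InV k x → ∀ j b →
                ∃[ y ] InV k y × y j ≡ b × (∀ l → l ≢ j → x l ≢ b → y l ≡ x l)
    InV-place x x∈V j b with p , xp≡b ← InV-occurrence x x∈V b =
      x ∘ (transpose j p ⟨$⟩ʳ_) , InV-permute x (transpose j p) x∈V ,
      trans (cong x (transpose-left j p)) xp≡b ,
      λ l l≢j xl≢b → cong x (transpose-fixed j p l l≢j λ l≡p → xl≢b (trans (cong x l≡p) xp≡b))

    InV-prescribe₂ : ∀ {N} (x : Fin N → Fin r) → InV k x → ∀ {i j a b} → i ≢ j → a ≢ b →
                     ∃[ y ] InV k y × y i ≡ a × y j ≡ b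
    InV-prescribe₂ x x∈V {i} {j} {a} {b} i≢j a≢b
      with y , y∈V , yi≡a , _ ← InV-place x x∈V i a
      with z , z∈V , zj≡b , z≗y ← InV-place y y∈V j b
      = z , z∈V , trans (z≗y i i≢j λ yi≡b → a≢b (trans (sym yi≡a) yi≡b)) yi≡a , zj≡b

module _ {c ℓ} (M : CommutativeMonoid c ℓ) where
  open CommutativeMonoid M renaming (refl to ≈-refl; sym to ≈-sym; trans to ≈-trans)
  open CommutativeMonoidSum M
  open import Algebra.Properties.CommutativeMonoid.Mult M using (×-homo-+; ×-distrib-+) renaming (_×_ to _·_)
  open import Algebra.Properties.CommutativeSemigroup commutativeSemigroup using (xy∙z≈zy∙x; xy∙z≈xz∙y)
  open import Relation.Binary.Reasoning.Setoid setoid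

  sum-update : ∀ {n} (h h′ : Fin n → Carrier) i → (∀ l → l ≢ i → h l ≈ h′ l) → sum h ∙ h′ i ≈ sum h′ ∙ h i
  sum-update {suc n} h h′ i h≈h′ = begin
    sum h ∙ h′ i                        ≈⟨ ∙-congʳ (sum-remove h) ⟩
    (h i ∙ sum (removeAt h i)) ∙ h′ i   ≈⟨ xy∙z≈zy∙x _ _ _ ⟩
    (h′ i ∙ sum (removeAt h i)) ∙ h i   ≈⟨ ∙-congʳ (∙-congˡ (sum-cong-≋ λ l → h≈h′ (punchIn i l) (punchInᵢ≢i i l))) ⟩
    (h′ i ∙ sum (removeAt h′ i)) ∙ h i  ≈⟨ ∙-congʳ (sum-remove h′) ⟨
    sum h′ ∙ h i                        ∎

  sum-update₂ : ∀ {n} (h h′ : Fin n → Carrier) {i j} → i ≢ j → (∀ l → l ≢ i → l ≢ j → h l ≈ h′ l) →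
                sum h ∙ (h′ i ∙ h′ j) ≈ sum h′ ∙ (h i ∙ h j)
  sum-update₂ h h′ {i} {j} i≢j h≈h′ = begin
    sum h ∙ (h′ i ∙ h′ j)    ≈⟨ assoc _ _ _ ⟨
    (sum h ∙ h′ i) ∙ h′ j    ≈⟨ ∙-congʳ (∙-congˡ (reflexive (sym (updateAt-updates i h)))) ⟩
    (sum h ∙ h″ i) ∙ h′ j    ≈⟨ ∙-congʳ (sum-update h h″ i λ l l≢i → reflexive (sym (updateAt-minimal l i h l≢i))) ⟩
    (sum h″ ∙ h i) ∙ h′ j    ≈⟨ xy∙z≈xz∙y _ _ _ ⟩
    (sum h″ ∙ h′ j) ∙ h i    ≈⟨ ∙-congʳ (sum-update h″ h′ j h″≈h′) ⟩
    (sum h′ ∙ h″ j) ∙ h i    ≈⟨ ∙-congʳ (∙-congˡ (reflexive (updateAt-minimal j i h (i≢j ∘ sym)))) ⟩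
    (sum h′ ∙ h j) ∙ h i     ≈⟨ assoc _ _ _ ⟩
    sum h′ ∙ (h j ∙ h i)     ≈⟨ ∙-congˡ (comm _ _) ⟩
    sum h′ ∙ (h i ∙ h j)     ∎
    where
    h″ : Fin _ → Carrier
    h″ = updateAt h i (const (h′ i))
    h″≈h′ : ∀ l → l ≢ j → h″ l ≈ h′ l
    h″≈h′ l l≢j with l ≟ i
    ... | yes refl = reflexive (updateAt-updates l h)
    ... | no  l≢i  = ≈-trans (reflexive (updateAt-minimal l i h l≢i)) (h≈h′ l l≢i l≢j)

  sum-indicator : ∀ {r} (c : Fin r) (f : Fin r → Carrier) → sum (λ m → indicator (does (c ≟ m)) · f m) ≈ f c
  sum-indicator {suc r} zero    f = ≈-trans (∙-cong (identityʳ (f zero)) (sum-replicate-zero r)) (identityʳ (f zero))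
  sum-indicator {suc r} (suc c) f = ≈-trans (identityˡ _) (sum-indicator c (f ∘ suc))

  sum-fibres : ∀ {N r} (x : Fin N → Fin r) (f : Fin r → Carrier) → sum (f ∘ x) ≈ sum (λ m → occurrences x m · f m)
  sum-fibres {zero}  {r} x f = ≈-sym (sum-replicate-zero r)
  sum-fibres {suc N}     x f = begin
    f (x zero) ∙ sum (f ∘ x ∘ suc)      ≈⟨ ∙-cong (≈-sym (sum-indicator (x zero) f)) (sum-fibres (x ∘ suc) f) ⟩
    sum head· ∙ sum tail·              ≈⟨ ∑-distrib-+ head· tail· ⟨
    sum (λ m → head· m ∙ tail· m)       ≈⟨ sum-cong-≋ (λ m → ×-homo-+ (f m) (indicator (does (x zero ≟ m))) _) ⟨
    sum (λ m → occurrences x m · f m)   ∎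
    where
    head· tail· : Fin _ → Carrier
    head· m = indicator (does (x zero ≟ m)) · f m
    tail· m = occurrences (x ∘ suc) m · f m

  sum-· : ∀ {r} (k : Fin r → ℕ) (u : Carrier) → sum (λ m → k m · u) ≈ ℕΣ.sum k · u
  sum-· {zero}  k u = ≈-refl
  sum-· {suc r} k u = ≈-trans (∙-congˡ (sum-· (k ∘ suc) u)) (≈-sym (×-homo-+ u (k zero) _))

  sum-·-shift : ∀ {r} (k : Fin r → ℕ) (u : Carrier) (w : Fin r → Carrier) →
                sum (λ m → k m · (u ∙ w m)) ≈ ℕΣ.sum k · u ∙ sum (λ m → k m · w m)
  sum-·-shift k u w = begin
    sum (λ m → k m · (u ∙ w m))                    ≈⟨ sum-cong-≋ (λ m → ×-distrib-+ u (w m) (k m)) ⟩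
    sum (λ m → k m · u ∙ k m · w m)                ≈⟨ ∑-distrib-+ (λ m → k m · u) (λ m → k m · w m) ⟩
    sum (λ m → k m · u) ∙ sum (λ m → k m · w m)    ≈⟨ ∙-congʳ (sum-· k u) ⟩
    ℕΣ.sum k · u ∙ sum (λ m → k m · w m)           ∎

module _ {c ℓ} (R : CommutativeRing c ℓ) where
  open CommutativeRing R hiding (zero) renaming (refl to ≈-refl; sym to ≈-sym; trans to ≈-trans)
  open CommutativeMonoidSum +-commutativeMonoid using (sum; sum-cong-≋; sum-cong-≗)
  open import Algebra.Properties.Semiring.Mult semiring using (×-congʳ; ×-assoc-*) renaming (_×_ to _·_)
  open import Algebra.Properties.CommutativeMonoid.Mult +-commutativeMonoid using (×-distrib-+)
  open import Algebra.Properties.AbelianGroup +-abelianGroup using (identityˡ-unique; x∙y⁻¹≈ε⇒x≈y; //-rightDividesˡ)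
  open import Relation.Binary.Reasoning.Setoid setoid

  sumR≡sum : ∀ {n} (f : Fin n → Carrier) → sumR R f ≡ sum f
  sumR≡sum = foldr-map-allFin _+_ 0#

  natMul≡· : ∀ n a → natMul R n a ≡ n · a
  natMul≡· zero    a = refl
  natMul≡· (suc n) a = cong (a +_) (natMul≡· n a)

  natMul-1#-* : ∀ n a → natMul R n 1# * a ≈ n · a
  natMul-1#-* n a = begin
    natMul R n 1# * a ≈⟨ *-congʳ (reflexive (natMul≡· n 1#)) ⟩
    (n · 1#) * a      ≈⟨ ×-assoc-* n 1# a ⟩
    n · (1# * a)      ≈⟨ ×-congʳ n (*-identityˡ a) ⟩
    n · a             ∎

  ·-cancel : TorsionFree R → ∀ n .{{_ : NonZero n}} {a b} → n · a ≈ n · b → a ≈ b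
  ·-cancel torsionFree (suc n) {a} {b} na≈nb = x∙y⁻¹≈ε⇒x≈y a b (torsionFree n (a - b) n[a-b]≈0)
    where
    n[a-b]≈0 : natMul R (suc n) (a - b) ≈ 0#
    n[a-b]≈0 = ≈-trans (reflexive (natMul≡· (suc n) (a - b))) (identityˡ-unique _ _ (begin
      suc n · (a - b) + suc n · b   ≈⟨ ×-distrib-+ (a - b) b (suc n) ⟨
      suc n · (a - b + b)           ≈⟨ ×-congʳ (suc n) (//-rightDividesˡ b a) ⟩
      suc n · a                     ≈⟨ na≈nb ⟩
      suc n · b                     ∎))

  module _ {r} (k : Fin r → ℕ) where

    Centred : (Fin r → Carrier) → Set ℓ
    Centred w = sum (λ m → k m · w m) ≈ 0#

    natMul-centred⇒centred : ∀ w → sumR R (λ m → natMul R (k m) 1# * w m) ≈ 0# → Centred w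
    natMul-centred⇒centred w w-centred = begin
      sum (λ m → k m · w m)                      ≈⟨ sum-cong-≋ (λ m → natMul-1#-* (k m) (w m)) ⟨
      sum (λ m → natMul R (k m) 1# * w m)        ≡⟨ sumR≡sum (λ m → natMul R (k m) 1# * w m) ⟨
      sumR R (λ m → natMul R (k m) 1# * w m)     ≈⟨ w-centred ⟩
      0#                                         ∎

    centred-vanishes : ∀ {N} w → Centred w → (x : Fin N → Fin r) → InV k x → sum (w ∘ x) ≈ 0#
    centred-vanishes w w-centred x x∈V = begin
      sum (w ∘ x)                          ≈⟨ sum-fibres +-commutativeMonoid x w ⟩
      sum (λ m → occurrences x m · w m)    ≡⟨ sum-cong-≗ (λ m → cong (_· w m) (InV⇒occurrences k x x∈V m)) ⟩
      sum (λ m → k m · w m)                ≈⟨ w-centred ⟩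
      0#                                   ∎

    total-of-centred-shift : ∀ {u u′ w w′} → Centred w → Centred w′ → (∀ a → u + w a ≈ u′ + w′ a) →
                             ℕΣ.sum k · u ≈ ℕΣ.sum k · u′
    total-of-centred-shift {u} {u′} {w} {w′} w-centred w′-centred shift = begin
      ℕΣ.sum k · u                                ≈⟨ +-identityʳ _ ⟨
      ℕΣ.sum k · u + 0#                           ≈⟨ +-congˡ w-centred ⟨
      ℕΣ.sum k · u + sum (λ a → k a · w a)        ≈⟨ sum-·-shift +-commutativeMonoid k u w ⟨
      sum (λ a → k a · (u + w a))                 ≈⟨ sum-cong-≋ (λ a → ×-congʳ (k a) (shift a)) ⟩
      sum (λ a → k a · (u′ + w′ a))               ≈⟨ sum-·-shift +-commutativeMonoid k u′ w′ ⟩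
      ℕΣ.sum k · u′ + sum (λ a → k a · w′ a)      ≈⟨ +-congˡ w′-centred ⟩
      ℕΣ.sum k · u′ + 0#                          ≈⟨ +-identityʳ _ ⟩
      ℕΣ.sum k · u′                               ∎

    module _ {N} (g : Fin N → Fin r → Carrier) where

      VanishesOnV : Set ℓ
      VanishesOnV = (x : Fin N → Fin r) → InV k x → sumR R (λ i → g i (x i)) ≈ 0#

      equal⇒vanishing : ∀ i₀ → Centred (g i₀) → (∀ i j m → g i m ≈ g j m) → VanishesOnV
      equal⇒vanishing i₀ g-centred g-equal x x∈V = begin
        sumR R (λ i → g i (x i))   ≡⟨ sumR≡sum (λ i → g i (x i)) ⟩
        sum (λ i → g i (x i))      ≈⟨ sum-cong-≋ (λ i → g-equal i i₀ (x i)) ⟩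
        sum (g i₀ ∘ x)             ≈⟨ centred-vanishes (g i₀) g-centred x x∈V ⟩
        0#                         ∎

      exchange : VanishesOnV → (x : Fin N → Fin r) → InV k x → ∀ {i j} → i ≢ j →
                 g i (x j) + g j (x i) ≈ g i (x i) + g j (x j)
      exchange g-vanishes x x∈V {i} {j} i≢j = begin
        g i (x j) + g j (x i)    ≡⟨ cong₂ _+_ (cong (g i ∘ x) (sym (transpose-left i j)))
                                              (cong (g j ∘ x) (sym (transpose-right i j))) ⟩
        g̃ i + g̃ j               ≈⟨ +-identityˡ _ ⟨
        0# + (g̃ i + g̃ j)        ≈⟨ +-congʳ (g-vanishes x x∈V) ⟨
        sumR R ĝ + (g̃ i + g̃ j)  ≡⟨ cong (_+ (g̃ i + g̃ j)) (sumR≡sum ĝ) ⟩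
        sum ĝ + (g̃ i + g̃ j)     ≈⟨ sum-update₂ +-commutativeMonoid ĝ g̃ i≢j ĝ≈g̃ ⟩
        sum g̃ + (ĝ i + ĝ j)     ≡⟨ cong (_+ (ĝ i + ĝ j)) (sumR≡sum g̃) ⟨
        sumR R g̃ + (ĝ i + ĝ j)  ≈⟨ +-congʳ (g-vanishes y (InV-permute k x τ x∈V)) ⟩
        0# + (ĝ i + ĝ j)        ≈⟨ +-identityˡ _ ⟩
        g i (x i) + g j (x j)    ∎
        where
        τ = transpose i j
        y = x ∘ (τ ⟨$⟩ʳ_)
        ĝ g̃ : Fin N → Carrier
        ĝ l = g l (x l)
        g̃ l = g l (y l)
        ĝ≈g̃ : ∀ l → l ≢ i → l ≢ j → ĝ l ≈ g̃ l
        ĝ≈g̃ l l≢i l≢j = reflexive (cong (g l ∘ x) (sym (transpose-fixed i j l l≢i l≢j)))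

      module _ (k-positive : ∀ m → 1 ≤ k m) where

        exchange-values : VanishesOnV → (x : Fin N → Fin r) → InV k x → ∀ {i j} → i ≢ j →
                          ∀ a b → g i b + g j a ≈ g i a + g j b
        exchange-values g-vanishes x x∈V i≢j a b with a ≟ b
        ... | yes refl = ≈-refl
        ... | no  a≢b with y , y∈V , refl , refl ← InV-prescribe₂ k k-positive x x∈V i≢j a≢b =
          exchange g-vanishes y y∈V i≢j

        vanishing⇒equal : TorsionFree R → sumℕ k ≡ N → .{{NonZero N}} → (∀ i → Centred (g i)) →
                          VanishesOnV → ∀ i j m → g i m ≈ g j m
        vanishing⇒equal torsionFree Σk≡N g-centred g-vanishes i j m with i ≟ j
        ... | yes refl = ≈-refl
        ... | no  i≢j  = ·-cancel torsionFree N (subst (λ t → t · g i m ≈ t · g j m) (trans (sym (sumℕ≡sum k)) Σk≡N)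
          (total-of-centred-shift (g-centred j) (g-centred i) λ a →
            ≈-trans (exchange-values g-vanishes x₀ x₀∈V i≢j a m) (+-comm _ _)))
          where
          x₀ = proj₁ (InV-inhabited k Σk≡N)
          x₀∈V = proj₂ (InV-inhabited k Σk≡N)

lemma4p3 : ∀ {c ℓ} (R : CommutativeRing c ℓ) → TorsionFree R →
  (N r : ℕ) → 2 ≤ N → 2 ≤ r →
  (k : Fin r → ℕ) → (∀ m → 1 ≤ k m) → sumℕ k ≡ N →
  (g : Fin N → Fin r → CommutativeRing.Carrier R) →
  (∀ i → CommutativeRing._≈_ R (sumR R (λ m → CommutativeRing._*_ R (natMul R (k m) (CommutativeRing.1# R)) (g i m))) (CommutativeRing.0# R)) →
  ((∀ (x : Fin N → Fin r) → InV k x → CommutativeRing._≈_ R (sumR R (λ i → g i (x i))) (CommutativeRing.0# R)) → (∀ i j m → CommutativeRing._≈_ R (g i m) (g j m)))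
  × ((∀ i j m → CommutativeRing._≈_ R (g i m) (g j m)) → (∀ (x : Fin N → Fin r) → InV k x → CommutativeRing._≈_ R (sumR R (λ i → g i (x i))) (CommutativeRing.0# R)))
lemma4p3 R torsionFree (suc _) r (s≤s _) _ k k-positive Σk≡N g g-natMul-centred =
  vanishing⇒equal R k g k-positive torsionFree Σk≡N g-centred , equal⇒vanishing R k g zero (g-centred zero)
  where
  g-centred : ∀ i → Centred R k (g i)
  g-centred i = natMul-centred⇒centred R k (g i) (g-natMul-centred i)
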